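{- In the epoch setting, assume in addition that $\mathcal{G}$ is $\Delta$-temporally connected. If $(s_1,\dots,s_\rho)\in S^{(1)}\times\cdots\times S^{(\rho)}$ is $I$-covering for every $I\in\mathcal{I}$, then for every vertex $v$ there is a temporal walk starting at $v$ that visits all vertices of $\mathcal{G}$ and uses only time steps lying in the $\rho$ epochs.
   Context: A temporal graph $\mathcal{G}=\langle G_1,\dots,G_L\rangle$ is a sequence of graphs (snapshots) on a common vertex set $V$, here with $|V|=n\ge2$. Its underlying graph is the union of all snapshots. A temporal walk is a sequence $(v_0,e_1,v_1,\dots,e_\ell,v_\ell)$ with time steps $t_1<\dots<t_\ell$ such that each $e_j=\{v_{j-1},v_j\}$ is present in $G_{t_j}$. $\mathcal{G}$ is $\Delta$-temporally connected if for every $t\in[L-\Delta+1]$ and every ordered pair of vertices $u,w$ there is a temporal walk from $u$ to $w$ using only time steps in $[t,t+\Delta-1]$. Let $k\ge1$ and $\Delta\ge1$, and let $T$ be a spanning tree of the underlying graph. A snapshot is $k$-edge-deficient w.r.t. $T$ if it contains all but at most $k$ edges of $T$. DFS tour. Fix a DFS tour of $T$ from a root back to the root traversing each edge twice, written $(v_1,\dots,v_N,v_{N+1})$ with $v_{N+1}=v_1$, $N=2(n-1)$, $e_q=\{v_q,v_{q+1}\}$. The circular interval $[i,j]$ is $\{i,\dots,j\}$ if $i\le j$ and $\{i,\dots,N,1,\dots,j\}$ otherwise; $[i,j)=[i,j]\setminus\{j\}$. Roundabout process on graphs $H_1,\dots,H_t$, each $k$-edge-deficient w.r.t. $T$. Agents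 $a_1,\dots,a_N$ start at $s_p(0)=p$, and $A(0)$ is all agents. At step $u$: (1) an agent in state $q$ moves to $(q\bmod N)+1$ if $e_q\in E(H_u)$, and stays otherwise; (2) with $D_p(u)=[p,s_p(u)]$, agents are removed one at a time from $A(u-1)$ while some remaining agent's $D_p(u)$ is covered by the union of the other remaining agents' $D$'s; the result is $A(u)$. Epoch setting. Let $t=\lfloor N/(2k)\rfloor$ and $\rho=\lceil 18k\ln(6k)\rceil$. An initial part of $[L]$ is partitioned into $\rho$ consecutive epochs, each containing at least $\Delta+n/k$ snapshots that are $k$-edge-deficient w.r.t. $T$. The first $\Delta$ time steps of an epoch form its repositioning part and the rest its roundabout part. In epoch $i$, the roundabout process is run on the first $t$ snapshots of the roundabout part that are $k$-edge-deficient w.r.t. $T$. $A^{(i)}$ is the set of agents active after step $t$ in epoch $i$, and $S^{(i)}$ the set of their initial states. With $\bigcup_iS^{(i)}=\{m_1<\dots<m_d\}$, set $I_j=[m_j,m_{j+1})$ for $j<d$, $I_d=[m_d,m_1)$, and $\mathcal{I}=\{I_1,\dots,I_d\}$. A tuple $(s_1,\dots,s_\rho)$ is $I$-covering if for some $i\in[\rho]$ the agent of $A^{(i)}$ with initial state $s_i$ visits all states of $I$ during epoch $i$'s roundabout process. -}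

module Defs where

open import Data.Nat using (ℕ; zero; suc; _+_; _*_; _∸_; _^_; _!; _≤_; _<_; _≤ᵇ_; _<ᵇ_; _≡ᵇ_)
open import Data.Nat.DivMod using (_/_)
open import Data.Bool using (Bool; true; false; _∧_; _∨_; not; if_then_else_)
open import Data.Fin using (Fin)
import Data.Fin as F
open import Data.List using (List; []; _∷_; length; map; take; upTo; filterᵇ)
open import Data.Nat.ListAction using (sum)
open import Data.List.Membership.Propositional using (_∈_)
open import Data.List.Relation.Unary.All using (All)
open import Data.List.Relation.Unary.Any using (Any)
open import Data.Product using (Σ; ∃; _×_; _,_; proj₁; proj₂)
open import Data.Sum using (_⊎_)
open import Data.Unit using (⊤)
open import Relation.Binary.PropositionalEquality using (_≡_; _≢_)
open import Relation.Nullary using (¬_; does)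

interval : ℕ → ℕ → List ℕ
interval a b = map (a +_) (upTo (suc b ∸ a))

count : {A : Set} → (A → Bool) → List A → ℕ
count p []       = 0
count p (x ∷ xs) = if p x then suc (count p xs) else count p xs

-- 1-indexed lookup in a list of naturals (default 0, never used below)
at : List ℕ → ℕ → ℕ
at []       u             = 0
at (x ∷ xs) zero          = 0
at (x ∷ xs) (suc zero)    = x
at (x ∷ xs) (suc (suc u)) = at xs (suc u)

without : ℕ → List ℕ → List ℕ
without p []       = []
without p (x ∷ xs) = if x ≡ᵇ p then without p xs else x ∷ without p xs

-- a snapshot: the undirected edge {u,v} (u ≠ v) is present iff
-- G u v or G v u holds (see edgeIn)
Graph : ℕ → Set
Graph n = Fin n → Fin n → Bool

eqFin : ∀ {n} → Fin n → Fin n → Bool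
eqFin a b = does (a F.≟ b)

edgeIn : ∀ {n} → Graph n → Fin n → Fin n → Bool
edgeIn G u v = not (eqFin u v) ∧ (G u v ∨ G v u)

-- a temporal graph of lifetime L is given by its snapshots G τ, τ ∈ [1,L]
TGraph : ℕ → Set
TGraph n = ℕ → Graph n

-- temporal walk from v, listed as (time step, next vertex) pairs,
-- with strictly increasing time steps (all ≥ 1 when prev = 0)
IsTWalk : ∀ {n} → TGraph n → ℕ → Fin n → List (ℕ × Fin n) → Set
IsTWalk G prev v []             = ⊤
IsTWalk G prev v ((τ , w) ∷ ws) = prev < τ × edgeIn (G τ) v w ≡ true × IsTWalk G τ w ws

lastV : ∀ {n} → Fin n → List (ℕ × Fin n) → Fin n
lastV v []             = v
lastV v ((_ , w) ∷ ws) = lastV w ws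

TemporallyConnected : (n L Δ : ℕ) → TGraph n → Set
TemporallyConnected n L Δ G =
  ∀ τ → 1 ≤ τ → τ + Δ ∸ 1 ≤ L → (u w : Fin n) →
  ∃ λ ws → IsTWalk G 0 u ws × lastV u ws ≡ w ×
           All (λ st → τ ≤ proj₁ st × proj₁ st ≤ τ + Δ ∸ 1) ws

UEdge : ∀ {n} → ℕ → TGraph n → Fin n → Fin n → Set
UEdge L G u v = ∃ λ τ → 1 ≤ τ × τ ≤ L × edgeIn (G τ) u v ≡ true

Edge : ℕ → Set
Edge n = Fin n × Fin n

sameEdge : ∀ {n} → Edge n → Edge n → Bool
sameEdge (a , b) (c , d) = (eqFin a c ∧ eqFin b d) ∨ (eqFin a d ∧ eqFin b c)

data TPath {n : ℕ} (T : List (Edge n)) : Fin n → Fin n → Set where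
  here : ∀ {v} → TPath T v v
  step : ∀ {v w x} → Any (λ e → sameEdge e (v , w) ≡ true) T → TPath T w x → TPath T v x

IsSpanningTree : (n L : ℕ) → TGraph n → List (Edge n) → Set
IsSpanningTree n L G T =
  length T ≡ n ∸ 1 ×
  All (λ e → UEdge L G (proj₁ e) (proj₂ e)) T ×
  (∀ (v w : Fin n) → TPath T v w)

tourLen : ℕ → ℕ
tourLen n = 2 * (n ∸ 1)

nxt : ℕ → ℕ → ℕ
nxt N q = if q <ᵇ N then suc q else 1

-- the tour is (tour 1, …, tour N, tour (N+1) = tour 1); e_q = {v_q, v_{q+1}}
tourEdge : ∀ {n} → ℕ → (ℕ → Fin n) → ℕ → Edge n
tourEdge N tour q = (tour q , tour (nxt N q))

IsDFSTour : (n : ℕ) → List (Edge n) → (ℕ → Fin n) → Set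
IsDFSTour n T tour =
  (∀ q → 1 ≤ q → q ≤ tourLen n →
     Any (λ e → sameEdge e (tourEdge (tourLen n) tour q) ≡ true) T) ×
  All (λ e → count (λ q → sameEdge e (tourEdge (tourLen n) tour q))
                   (interval 1 (tourLen n)) ≡ 2) T

deficient : ∀ {n} → ℕ → List (Edge n) → Graph n → Bool
deficient k T H = count (λ e → not (edgeIn H (proj₁ e) (proj₂ e))) T ≤ᵇ k

inCI : ℕ → ℕ → ℕ → Bool
inCI i j x = if i ≤ᵇ j then ((i ≤ᵇ x) ∧ (x ≤ᵇ j)) else ((i ≤ᵇ x) ∨ (x ≤ᵇ j))

inCO : ℕ → ℕ → ℕ → Bool
inCO i j x = inCI i j x ∧ not (x ≡ᵇ j)

pos : ∀ {n} → ℕ → (ℕ → Fin n) → (ℕ → Graph n) → ℕ → ℕ → ℕ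
pos N tour H p zero    = p
pos N tour H p (suc u) =
  if edgeIn (H (suc u)) (tour (pos N tour H p u)) (tour (nxt N (pos N tour H p u)))
  then nxt N (pos N tour H p u) else pos N tour H p u

-- D_p(u) is covered by the union of the D_q(u), q ∈ A, q ≠ p
-- (agents are identified with their index p = initial state)
Covered : ∀ {n} → ℕ → (ℕ → Fin n) → (ℕ → Graph n) → ℕ → List ℕ → ℕ → Set
Covered N tour H u A p =
  ∀ x → 1 ≤ x → x ≤ N → inCI p (pos N tour H p u) x ≡ true →
  ∃ λ q → q ∈ A × q ≢ p × inCI q (pos N tour H q u) x ≡ true

data Prune (cov : List ℕ → ℕ → Set) : List ℕ → List ℕ → Set where
  stop   : ∀ {A} → (∀ p → p ∈ A → ¬ cov A p) → Prune cov A A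
  remove : ∀ {A B p} → p ∈ A → cov A p → Prune cov (without p A) B → Prune cov A B

IsRun : ∀ {n} → ℕ → (ℕ → Fin n) → (ℕ → Graph n) → ℕ → (ℕ → List ℕ) → Set
IsRun N tour H t As =
  As 0 ≡ interval 1 N ×
  (∀ u → 1 ≤ u → u ≤ t → Prune (Covered N tour H u) (As (u ∸ 1)) (As u))

tSteps : ℕ → ℕ → ℕ
tSteps N zero    = 0
tSteps N (suc k) = N / (2 * suc k)

-- ρ = ⌈18 k ln(6k)⌉, expressed without reals.  With M = (6k)^(18k),
-- ρ = ⌈18k ln(6k)⌉ ⇔ e^(ρ-1) < M ≤ e^ρ.  Since e^m is never an integer > 1,
-- this is  e^ρ > M  and not (e^(ρ-1) > M),  and e^m > M holds iff some
-- partial sum Σ_{j≤J} m^j / j! exceeds M.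

pr : ℕ → ℕ → ℕ
pr j zero    = 1
pr j (suc J) = if j ≤ᵇ J then suc J * pr j J else 1

-- J! * Σ_{j=0}^{J} m^j / j!
expScaled : ℕ → ℕ → ℕ
expScaled m J = sum (map (λ j → m ^ j * pr j J) (upTo (suc J)))

-- e^m > M
ExpGreater : ℕ → ℕ → Set
ExpGreater m M = ∃ λ J → M * (J !) < expScaled m J

IsRho : ℕ → ℕ → Set
IsRho k ρ = ExpGreater ρ ((6 * k) ^ (18 * k)) × ¬ ExpGreater (ρ ∸ 1) ((6 * k) ^ (18 * k))

-- epoch i (1 ≤ i ≤ ρ) is the time interval [b(i-1)+1, b i]
Epochs : ∀ {n} → (k Δ L : ℕ) → TGraph n → List (Edge n) → ℕ → (ℕ → ℕ) → Set
Epochs {n} k Δ L G T ρ b =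
  b 0 ≡ 0 ×
  (∀ i → 1 ≤ i → i ≤ ρ → b (i ∸ 1) < b i) ×
  b ρ ≤ L ×
  -- at least Δ + n/k k-edge-deficient snapshots in each epoch
  (∀ i → 1 ≤ i → i ≤ ρ →
     k * Δ + n ≤ k * count (λ τ → deficient k T (G τ)) (interval (suc (b (i ∸ 1))) (b i)))

InEpochs : ℕ → (ℕ → ℕ) → ℕ → Set
InEpochs ρ b τ = ∃ λ i → 1 ≤ i × i ≤ ρ × b (i ∸ 1) < τ × τ ≤ b i

-- the snapshots H_1, …, H_t on which the roundabout process of epoch i runs:
-- the first t k-edge-deficient snapshots of the roundabout part
-- [b(i-1)+1+Δ, b i] of epoch i
roundTimes : ∀ {n} → (k Δ : ℕ) → TGraph n → List (Edge n) → (ℕ → ℕ) → ℕ → List ℕ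
roundTimes {n} k Δ G T b i =
  take (tSteps (tourLen n) k)
       (filterᵇ (λ τ → deficient k T (G τ)) (interval (suc (b (i ∸ 1)) + Δ) (b i)))

Hep : ∀ {n} → (k Δ : ℕ) → TGraph n → List (Edge n) → (ℕ → ℕ) → ℕ → ℕ → Graph n
Hep k Δ G T b i u = G (at (roundTimes k Δ G T b i) u)

-- m ∈ ⋃_i S^(i)  (S^(i) = A^(i) since agent a_p has initial state p)
InUnion : ℕ → (ℕ → List ℕ) → ℕ → Set
InUnion ρ Afin m = ∃ λ i → 1 ≤ i × i ≤ ρ × m ∈ Afin i

-- m, m' are cyclically consecutive elements of the union, so [m, m') ∈ 𝓘
Consecutive : ℕ → (ℕ → List ℕ) → ℕ → ℕ → Set
Consecutive ρ Afin m m' =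
  InUnion ρ Afin m × InUnion ρ Afin m' ×
  ((m < m' × (∀ y → InUnion ρ Afin y → ¬ (m < y × y < m'))) ⊎
   ((∀ y → InUnion ρ Afin y → y ≤ m) × (∀ y → InUnion ρ Afin y → m' ≤ y)))

-- Each epoch i contributes a walk: its repositioning part, Δ time steps long, takes the walk to
-- tour(s_i) by Δ-temporal connectivity, and during its roundabout part the walk shadows the agent
-- with initial state s_i, crossing e_q at the very snapshot in which the agent advances along it.
-- (The epoch condition leaves at least t deficient snapshots for the roundabout part.)  The
-- concatenated walk therefore visits tour(q) for every state q that one of these agents passes.
-- Every vertex lies on the DFS tour, every state lies in an interval of 𝓘, and each interval is
-- traversed by one of the agents.  That 𝓘 covers the circle needs ⋃ S^(i) to have two elements:
-- the intervals D_p of the active agents always cover the circle, while a single agent, having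
-- moved at most t < N - 1 steps, covers fewer than N states.  For n = 2 this may fail, but then
-- one repositioning walk to the other vertex suffices.
{-# OPTIONS --safe #-}
module Submission where

open import Defs
open import Data.Bool using (Bool; true; false; T; T?; _∧_; if_then_else_)
open import Data.Bool.Properties using (T-≡; T-∧; T-∨; ∨-zeroʳ)
open import Data.Empty using (⊥-elim)
open import Data.Fin using (Fin)
import Data.Fin as F
open import Data.List using (List; []; _∷_; map; length; _++_; take; upTo; applyUpTo; filterᵇ)
open import Data.List.Membership.Propositional using (_∈_; find)
open import Data.List.Membership.Propositional.Properties
  using (∈-map⁺; ∈-map⁻; ∈-upTo⁺; ∈-upTo⁻; ∈-++⁺ˡ; ∈-++⁺ʳ; ∈-++⁻)
open import Data.List.Properties using (map-applyUpTo; map-++; length-take)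
open import Data.List.Relation.Unary.All as All using (All; []; _∷_)
import Data.List.Relation.Unary.All.Properties as All
open import Data.List.Relation.Unary.AllPairs using (AllPairs; []; _∷_)
import Data.List.Relation.Unary.AllPairs.Properties as AllPairs
open import Data.List.Relation.Unary.Any using (here; there)
open import Data.Nat
open import Data.Nat.DivMod using (_/_; m/n*n≤m; m*n/m*o≡n/o)
open import Data.Nat.Properties
open import Data.Product using (Σ; ∃; ∃₂; _×_; _,_; proj₁; proj₂)
open import Data.Sum using (_⊎_; inj₁; inj₂)
open import Data.Unit using (tt)
open import Function using (_∘_; Equivalence)
open import Relation.Binary.PropositionalEquality
open import Relation.Nullary using (¬_; yes; no)
open import Relation.Nullary.Reflects using (Reflects; ofʸ; ofⁿ; fromEquivalence)
open import Relation.Unary using (Decidable)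

≤ᵇ-true : ∀ {m n} → m ≤ n → (m ≤ᵇ n) ≡ true
≤ᵇ-true m≤n = Equivalence.to T-≡ (≤⇒≤ᵇ m≤n)

≡ᵇ-reflects-≡ : ∀ m n → Reflects (m ≡ n) (m ≡ᵇ n)
≡ᵇ-reflects-≡ m n = fromEquivalence (≡ᵇ⇒≡ m n) (≡⇒≡ᵇ m n)

≡ᵇ-false : ∀ {m n} → m ≢ n → (m ≡ᵇ n) ≡ false
≡ᵇ-false {m} {n} m≢n with m ≡ᵇ n | ≡ᵇ-reflects-≡ m n
... | true  | ofʸ m≡n = ⊥-elim (m≢n m≡n)
... | false | _       = refl

count≡length-filterᵇ : ∀ {A : Set} (p : A → Bool) xs → count p xs ≡ length (filterᵇ p xs)
count≡length-filterᵇ p [] = refl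
count≡length-filterᵇ p (x ∷ xs) with p x
... | true  = cong suc (count≡length-filterᵇ p xs)
... | false = count≡length-filterᵇ p xs

count-∷-≤ : ∀ {A : Set} (p : A → Bool) x xs → count p (x ∷ xs) ≤ suc (count p xs)
count-∷-≤ p x xs with p x
... | true  = ≤-refl
... | false = n≤1+n _

count-pos : ∀ {A : Set} (p : A → Bool) xs → 0 < count p xs → ∃ λ x → x ∈ xs × p x ≡ true
count-pos p (x ∷ xs) pos with p x in px
... | true  = x , here refl , px
... | false with count-pos p xs pos
...   | y , y∈xs , py = y , there y∈xs , py

∈-interval⁻ : ∀ {a c y} → y ∈ interval a c → a ≤ y × y ≤ c
∈-interval⁻ {a} {c} y∈ with ∈-map⁻ (a +_) y∈
... | i , i∈ , refl =
  m≤m+n a i , subst (_≤ c) (+-comm i a) (≤-pred (m≤o∸n⇒m+n≤o (suc i) a≤1+c (∈-upTo⁻ i∈)))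
  where
  a≤1+c : a ≤ suc c
  a≤1+c = <⇒≤ (m∸n≢0⇒n<m λ eq → n≮0 (subst (i <_) eq (∈-upTo⁻ i∈)))

∈-interval⁺ : ∀ {a c y} → a ≤ y → y ≤ c → y ∈ interval a c
∈-interval⁺ {a} {c} {y} a≤y y≤c =
  subst (_∈ interval a c) (m+[n∸m]≡n a≤y) (∈-map⁺ (a +_) (∈-upTo⁺ y∸a<))
  where
  y∸a< : y ∸ a < suc c ∸ a
  y∸a< = subst (_≤ suc c ∸ a) (+-∸-assoc 1 a≤y) (∸-monoˡ-≤ a (s≤s y≤c))

interval-∷ : ∀ {a c} → a ≤ c → interval a c ≡ a ∷ interval (suc a) c
interval-∷ {a} {c} a≤c = begin
  map (a +_) (upTo (suc c ∸ a))                   ≡⟨ cong (map (a +_) ∘ upTo) (+-∸-assoc 1 a≤c) ⟩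
  a + 0 ∷ map (a +_) (applyUpTo suc (c ∸ a))      ≡⟨ cong₂ _∷_ (+-identityʳ a) shift ⟩
  a ∷ map (suc a +_) (upTo (c ∸ a))               ∎
  where
  open ≡-Reasoning
  shift : map (a +_) (applyUpTo suc (c ∸ a)) ≡ map (suc a +_) (upTo (c ∸ a))
  shift = begin
    map (a +_) (applyUpTo suc (c ∸ a))            ≡⟨ map-applyUpTo suc (a +_) (c ∸ a) ⟩
    applyUpTo (λ i → a + suc i) (c ∸ a)           ≡⟨ applyUpTo-cong (λ i → +-suc a i) (c ∸ a) ⟩
    applyUpTo (λ i → suc a + i) (c ∸ a)           ≡⟨ map-applyUpTo (λ i → i) (suc a +_) (c ∸ a) ⟨
    map (suc a +_) (upTo (c ∸ a))                 ∎
    where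
    applyUpTo-cong : ∀ {f g : ℕ → ℕ} → (∀ i → f i ≡ g i) → ∀ m → applyUpTo f m ≡ applyUpTo g m
    applyUpTo-cong f≡g zero    = refl
    applyUpTo-cong f≡g (suc m) = cong₂ _∷_ (f≡g 0) (applyUpTo-cong (f≡g ∘ suc) m)

interval-empty : ∀ {a c} → c < a → interval a c ≡ []
interval-empty {a} {c} c<a = cong (map (a +_) ∘ upTo) (m≤n⇒m∸n≡0 c<a)

count-interval-drop : ∀ (p : ℕ → Bool) a c d → count p (interval a c) ≤ d + count p (interval (a + d) c)
count-interval-drop p a c zero = ≤-reflexive (cong (count p ∘ λ x → interval x c) (sym (+-identityʳ a)))
count-interval-drop p a c (suc d) = begin
  count p (interval a c)                     ≤⟨ count-interval-drop p a c d ⟩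
  d + count p (interval (a + d) c)           ≤⟨ +-monoʳ-≤ d (drop-one (a + d)) ⟩
  d + suc (count p (interval (suc (a + d)) c)) ≡⟨ +-suc d _ ⟩
  suc d + count p (interval (suc (a + d)) c) ≡⟨ cong (λ x → suc d + count p (interval x c)) (+-suc a d) ⟨
  suc d + count p (interval (a + suc d) c)   ∎
  where
  open ≤-Reasoning
  drop-one : ∀ x → count p (interval x c) ≤ suc (count p (interval (suc x) c))
  drop-one x with x ≤? c
  ... | yes x≤c rewrite interval-∷ x≤c = count-∷-≤ p x (interval (suc x) c)
  ... | no  x≰c rewrite interval-empty (≰⇒> x≰c) = z≤n

AllPairs-interval : ∀ a c → AllPairs _<_ (interval a c)
AllPairs-interval a c = AllPairs.map⁺ (AllPairs.applyUpTo⁺₁ (λ i → i) (suc c ∸ a) (λ i<j _ → +-monoʳ-< a i<j))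

at-< : ∀ {xs} u → AllPairs _<_ xs → suc (suc u) ≤ length xs → at xs (suc u) < at xs (suc (suc u))
at-< {x ∷ []}    zero    _                 (s≤s ())
at-< {x ∷ y ∷ _} zero    ((x<y ∷ _) ∷ _)   _       = x<y
at-< {x ∷ _}     (suc u) (_ ∷ sorted)      (s≤s h) = at-< u sorted h

at-All : ∀ {P : ℕ → Set} {xs} u → All P xs → suc u ≤ length xs → P (at xs (suc u))
at-All zero    (px ∷ _)   _       = px
at-All (suc u) (_ ∷ pxs)  (s≤s h) = at-All u pxs h

module _ {n : ℕ} (G : TGraph n) where

  IsTWalk-weaken : ∀ {lo lo' v} ws → lo ≤ lo' → IsTWalk G lo' v ws → IsTWalk G lo v ws
  IsTWalk-weaken []             _      _               = tt
  IsTWalk-weaken ((τ , w) ∷ ws) lo≤lo' (lo'<τ , e , h) = ≤-<-trans lo≤lo' lo'<τ , e , h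

  IsTWalk-++ : ∀ {lo mid v} ws ws' → lo ≤ mid → IsTWalk G lo v ws → All (λ st → proj₁ st ≤ mid) ws →
               IsTWalk G mid (lastV v ws) ws' → IsTWalk G lo v (ws ++ ws')
  IsTWalk-++ []             ws' lo≤mid _              _          h' = IsTWalk-weaken ws' lo≤mid h'
  IsTWalk-++ ((τ , w) ∷ ws) ws' _      (lo<τ , e , h) (τ≤mid ∷ b) h' = lo<τ , e , IsTWalk-++ ws ws' τ≤mid h b h'

  IsTWalk⇒after : ∀ {lo v} ws → IsTWalk G lo v ws → All (λ st → lo < proj₁ st) ws
  IsTWalk⇒after []             _              = []
  IsTWalk⇒after ((τ , w) ∷ ws) (lo<τ , _ , h) = lo<τ ∷ All.map (<-trans lo<τ) (IsTWalk⇒after ws h)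

  IsTWalk-after : ∀ {lo lo' v} ws → IsTWalk G lo' v ws → All (λ st → lo < proj₁ st) ws → IsTWalk G lo v ws
  IsTWalk-after []             _           _          = tt
  IsTWalk-after ((τ , w) ∷ ws) (_ , e , h) (lo<τ ∷ _) = lo<τ , e , h

lastV-++ : ∀ {n} (v : Fin n) ws ws' → lastV v (ws ++ ws') ≡ lastV (lastV v ws) ws'
lastV-++ v []             ws' = refl
lastV-++ v ((τ , w) ∷ ws) ws' = lastV-++ w ws ws'

lastV∈ : ∀ {n} (v : Fin n) ws → lastV v ws ∈ v ∷ map proj₂ ws
lastV∈ v []             = here refl
lastV∈ v ((τ , w) ∷ ws) = there (lastV∈ w ws)

record TWalkIn {n : ℕ} (G : TGraph n) (lo hi : ℕ) (v w : Fin n) : Set where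
  field
    steps   : List (ℕ × Fin n)
    isTWalk : IsTWalk G lo v steps
    endsAt  : lastV v steps ≡ w
    byHi    : All (λ st → proj₁ st ≤ hi) steps

  vertices : List (Fin n)
  vertices = v ∷ map proj₂ steps

  end∈vertices : w ∈ vertices
  end∈vertices = subst (_∈ vertices) endsAt (lastV∈ v steps)

open TWalkIn

module _ {n : ℕ} {G : TGraph n} where

  stay : ∀ {lo hi v} → TWalkIn G lo hi v v
  stay = record { steps = [] ; isTWalk = tt ; endsAt = refl ; byHi = [] }

  hop : ∀ {lo hi v w} τ → lo < τ → τ ≤ hi → edgeIn (G τ) v w ≡ true → TWalkIn G lo hi v w
  hop {w = w} τ lo<τ τ≤hi e =
    record { steps = (τ , w) ∷ [] ; isTWalk = lo<τ , e , tt ; endsAt = refl ; byHi = τ≤hi ∷ [] }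

  widen : ∀ {lo lo' hi hi' v w} → lo' ≤ lo → hi ≤ hi' → TWalkIn G lo hi v w → TWalkIn G lo' hi' v w
  widen lo'≤lo hi≤hi' σ = record
    { steps   = steps σ
    ; isTWalk = IsTWalk-weaken G (steps σ) lo'≤lo (isTWalk σ)
    ; endsAt  = endsAt σ
    ; byHi    = All.map (λ τ≤hi → ≤-trans τ≤hi hi≤hi') (byHi σ)
    }

  retarget : ∀ {lo hi v w w'} → w ≡ w' → TWalkIn G lo hi v w → TWalkIn G lo hi v w'
  retarget w≡w' σ = record
    { steps = steps σ ; isTWalk = isTWalk σ ; endsAt = trans (endsAt σ) w≡w' ; byHi = byHi σ }

  append : ∀ {lo mid hi u v w} → lo ≤ mid → mid ≤ hi →
           TWalkIn G lo mid u v → TWalkIn G mid hi v w → TWalkIn G lo hi u w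
  append {u = u} lo≤mid mid≤hi σ σ' = record
    { steps   = steps σ ++ steps σ'
    ; isTWalk = IsTWalk-++ G (steps σ) (steps σ') lo≤mid (isTWalk σ) (byHi σ)
                  (subst (λ x → IsTWalk G _ x (steps σ')) (sym (endsAt σ)) (isTWalk σ'))
    ; endsAt  = trans (lastV-++ u (steps σ) (steps σ')) (trans (cong (λ x → lastV x (steps σ')) (endsAt σ)) (endsAt σ'))
    ; byHi    = All.++⁺ (All.map (λ τ≤mid → ≤-trans τ≤mid mid≤hi) (byHi σ)) (byHi σ')
    }

  module _ {lo mid hi u v w} (lo≤mid : lo ≤ mid) (mid≤hi : mid ≤ hi)
           (σ : TWalkIn G lo mid u v) (σ' : TWalkIn G mid hi v w) where

    ∈-append⁺ˡ : ∀ {x} → x ∈ vertices σ → x ∈ vertices (append lo≤mid mid≤hi σ σ')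
    ∈-append⁺ˡ (here x≡u) = here x≡u
    ∈-append⁺ˡ (there x∈) = there (subst (_ ∈_) (sym (map-++ proj₂ (steps σ) (steps σ'))) (∈-++⁺ˡ x∈))

    ∈-append⁺ʳ : ∀ {x} → x ∈ vertices σ' → x ∈ vertices (append lo≤mid mid≤hi σ σ')
    ∈-append⁺ʳ (here refl) = ∈-append⁺ˡ (end∈vertices σ)
    ∈-append⁺ʳ (there x∈)  = there (subst (_ ∈_) (sym (map-++ proj₂ (steps σ) (steps σ'))) (∈-++⁺ʳ _ x∈))

reposition : ∀ {n L Δ} {G : TGraph n} → TemporallyConnected n L Δ G →
             ∀ lo → lo + Δ ≤ L → ∀ v w → TWalkIn G lo (lo + Δ) v w
reposition {G = G} tc lo bound v w with tc (suc lo) (s≤s z≤n) bound v w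
... | ws , walk , ends , within = record
  { steps   = ws
  ; isTWalk = IsTWalk-after G ws walk (All.map proj₁ within)
  ; endsAt  = ends
  ; byHi    = All.map proj₂ within
  }

≤-last : ∀ ρ (b : ℕ → ℕ) → (∀ j → j < ρ → b j < b (suc j)) → ∀ {j} → j ≤ ρ → b j ≤ b ρ
≤-last zero    b incr z≤n  = ≤-refl
≤-last (suc ρ) b incr j≤1+ρ with m≤n⇒m<n∨m≡n j≤1+ρ
... | inj₁ j<1+ρ =
  ≤-trans (≤-last ρ b (λ i i<ρ → incr i (m<n⇒m<1+n i<ρ)) (≤-pred j<1+ρ)) (<⇒≤ (incr ρ ≤-refl))
... | inj₂ refl  = ≤-refl

InEpochs⁺ : ∀ ρ (b : ℕ → ℕ) → b 0 ≡ 0 → (∀ j → j < ρ → b j < b (suc j)) →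
           ∀ {τ} → 0 < τ → τ ≤ b ρ → InEpochs ρ b τ
InEpochs⁺ zero    b b0≡0 incr 0<τ τ≤b0 = ⊥-elim (<⇒≱ 0<τ (subst (_ ≤_) b0≡0 τ≤b0))
InEpochs⁺ (suc ρ) b b0≡0 incr {τ} 0<τ τ≤b[1+ρ] with τ ≤? b ρ
... | yes τ≤bρ with InEpochs⁺ ρ b b0≡0 (λ j j<ρ → incr j (m<n⇒m<1+n j<ρ)) 0<τ τ≤bρ
...   | i , 1≤i , i≤ρ , after , before = i , 1≤i , m≤n⇒m≤1+n i≤ρ , after , before
InEpochs⁺ (suc ρ) b b0≡0 incr 0<τ τ≤b[1+ρ] | no τ≰bρ =
  suc ρ , s≤s z≤n , ≤-refl , ≰⇒> τ≰bρ , τ≤b[1+ρ]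

OnCircle : ℕ → ℕ → Set
OnCircle N q = 1 ≤ q × q ≤ N

nxt-OnCircle : ∀ {N q} → OnCircle N q → OnCircle N (nxt N q)
nxt-OnCircle {N} {q} (1≤q , q≤N) with q <ᵇ N | <ᵇ-reflects-< q N
... | true  | ofʸ q<N = s≤s z≤n , q<N
... | false | _       = ≤-refl , ≤-trans 1≤q q≤N

-- Clockwise distance from p to x; the circular interval [p, s] is {x | cdist N p x ≤ cdist N p s}.
cdist : ℕ → ℕ → ℕ → ℕ
cdist N p x = if p ≤ᵇ x then x ∸ p else N ∸ p + x

cdist-self : ∀ N p → cdist N p p ≡ 0
cdist-self N p with p ≤ᵇ p | ≤ᵇ-reflects-≤ p p
... | true  | _         = n∸n≡0 p
... | false | ofⁿ p≰p  = ⊥-elim (p≰p ≤-refl)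

inCI⇒cdist≤ : ∀ {N p s x} → x ≤ N → inCI p s x ≡ true → cdist N p x ≤ cdist N p s
inCI⇒cdist≤ {N} {p} {s} {x} x≤N h
  with p ≤ᵇ s | ≤ᵇ-reflects-≤ p s | p ≤ᵇ x | ≤ᵇ-reflects-≤ p x | x ≤ᵇ s | ≤ᵇ-reflects-≤ x s
inCI⇒cdist≤ {p = p} x≤N h | true  | _ | true  | _ | true  | ofʸ x≤s = ∸-monoˡ-≤ p x≤s
inCI⇒cdist≤ x≤N () | true  | _ | true  | _ | false | _
inCI⇒cdist≤ x≤N () | true  | _ | false | _ | _     | _
inCI⇒cdist≤ {N} {p} {s} x≤N h | false | _ | true | _ | _ | _ = ≤-trans (∸-monoˡ-≤ p x≤N) (m≤m+n (N ∸ p) s)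
inCI⇒cdist≤ x≤N h  | false | _ | false | _ | true  | ofʸ x≤s = +-monoʳ-≤ _ x≤s
inCI⇒cdist≤ x≤N () | false | _ | false | _ | false | _

cdist≤⇒inCI : ∀ {N p s x} → 1 ≤ x → s ≤ N → cdist N p x ≤ cdist N p s → inCI p s x ≡ true
cdist≤⇒inCI {N} {p} {s} {x} 1≤x s≤N h with p ≤ᵇ s | ≤ᵇ-reflects-≤ p s | p ≤ᵇ x | ≤ᵇ-reflects-≤ p x
... | true  | ofʸ p≤s | true  | ofʸ p≤x = ≤ᵇ-true (begin
  x           ≡⟨ m∸n+n≡m p≤x ⟨
  x ∸ p + p   ≤⟨ +-monoˡ-≤ p h ⟩
  s ∸ p + p   ≡⟨ m∸n+n≡m p≤s ⟩
  s           ∎)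
  where open ≤-Reasoning
... | true  | _       | false | _       = ⊥-elim (<⇒≱ (≤-<-trans (∸-monoˡ-≤ p s≤N) (m<m+n (N ∸ p) 1≤x)) h)
... | false | _       | true  | _       = refl
... | false | _       | false | _       = ≤ᵇ-true (+-cancelˡ-≤ (N ∸ p) x s h)

cdist-nxt : ∀ {N p s} → OnCircle N p → OnCircle N s → suc (cdist N p s) < N →
            cdist N p (nxt N s) ≡ suc (cdist N p s)
cdist-nxt {N} {p} {s} (1≤p , p≤N) (1≤s , s≤N) h with s <ᵇ N | <ᵇ-reflects-< s N
... | true | ofʸ s<N with p ≤ᵇ s | ≤ᵇ-reflects-≤ p s | p ≤ᵇ suc s | ≤ᵇ-reflects-≤ p (suc s)
...   | true  | ofʸ p≤s | true  | _         = +-∸-assoc 1 p≤s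
...   | true  | ofʸ p≤s | false | ofⁿ p≰1+s = ⊥-elim (p≰1+s (m≤n⇒m≤1+n p≤s))
...   | false | ofⁿ p≰s | true  | ofʸ p≤1+s = ⊥-elim (<-irrefl refl (subst (_< N) full h))
  where
  full : suc (N ∸ p + s) ≡ N
  full rewrite ≤-antisym p≤1+s (≰⇒> p≰s) = trans (sym (+-suc (N ∸ suc s) s)) (m∸n+n≡m s<N)
...   | false | _       | false | _         = +-suc (N ∸ p) s
cdist-nxt {N} {p} {s} (1≤p , p≤N) (1≤s , s≤N) h | false | ofⁿ s≮N
  with ≤-antisym s≤N (≮⇒≥ s≮N) | p ≤ᵇ 1 | ≤ᵇ-reflects-≤ p 1 | p ≤ᵇ s | ≤ᵇ-reflects-≤ p s
... | refl | true  | ofʸ p≤1 | true  | ofʸ p≤s  = ⊥-elim (<-irrefl refl (subst (_< s) full h))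
  where
  full : suc (s ∸ p) ≡ s
  full = trans (+-comm 1 (s ∸ p)) (trans (cong (s ∸ p +_) (≤-antisym 1≤p p≤1)) (m∸n+n≡m p≤s))
... | refl | false | _       | true  | _         = +-comm (s ∸ p) 1
... | refl | _     | _       | false | ofⁿ p≰s  = ⊥-elim (p≰s p≤N)

cpred : ℕ → ℕ → ℕ
cpred N zero          = N
cpred N (suc zero)    = N
cpred N (suc (suc m)) = suc m

cpred-OnCircle : ∀ {N m} → OnCircle N m → OnCircle N (cpred N m)
cpred-OnCircle {m = suc zero}    (_ , 1≤N) = 1≤N , ≤-refl
cpred-OnCircle {m = suc (suc m)} (_ , m≤N) = s≤s z≤n , ≤-trans (n≤1+n _) m≤N

cdist-cpred : ∀ {N m} → OnCircle N m → cdist N m (cpred N m) ≡ N ∸ 1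
cdist-cpred {N} {suc zero} (_ , 1≤N) with 1 ≤ᵇ N | ≤ᵇ-reflects-≤ 1 N
... | true  | _         = refl
... | false | ofⁿ 1≰N  = ⊥-elim (1≰N 1≤N)
cdist-cpred {suc N} {suc (suc m)} (_ , s≤s m<N) with suc (suc m) ≤ᵇ suc m | ≤ᵇ-reflects-≤ (suc (suc m)) (suc m)
... | true  | ofʸ m+2≤m+1 = ⊥-elim (<-irrefl refl m+2≤m+1)
... | false | _            = m∸n+n≡m m<N

without-⊆ : ∀ {p q} A → q ∈ without p A → q ∈ A
without-⊆ {p} (x ∷ A) q∈ with x ≡ᵇ p | q∈
... | true  | q∈'        = there (without-⊆ A q∈')
... | false | here q≡x   = here q≡x
... | false | there q∈'  = there (without-⊆ A q∈')

∈-without : ∀ {p q} A → q ∈ A → q ≢ p → q ∈ without p A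
∈-without (x ∷ A) (here refl) q≢p rewrite ≡ᵇ-false q≢p = here refl
∈-without {p} (x ∷ A) (there q∈) q≢p with x ≡ᵇ p
... | true  = ∈-without A q∈ q≢p
... | false = there (∈-without A q∈ q≢p)

prune-⊆ : ∀ {cov A B q} → Prune cov A B → q ∈ B → q ∈ A
prune-⊆ (stop _)                 q∈ = q∈
prune-⊆ (remove {A} {p = p} _ _ rest) q∈ = without-⊆ A (prune-⊆ rest q∈)

module Agent {n : ℕ} (N : ℕ) (tour : ℕ → Fin n) (H : ℕ → Graph n) where

  Moves : ℕ → ℕ → Set
  Moves p u = edgeIn (H (suc u)) (tour (pos N tour H p u)) (tour (nxt N (pos N tour H p u))) ≡ true

  pos-suc : ∀ p u → (Moves p u × pos N tour H p (suc u) ≡ nxt N (pos N tour H p u))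
                  ⊎ pos N tour H p (suc u) ≡ pos N tour H p u
  pos-suc p u with edgeIn (H (suc u)) (tour (pos N tour H p u)) (tour (nxt N (pos N tour H p u)))
  ... | true  = inj₁ (refl , refl)  -- the with-abstraction also rewrites the test inside Moves p u
  ... | false = inj₂ refl

  pos-OnCircle : ∀ {p} → OnCircle N p → ∀ u → OnCircle N (pos N tour H p u)
  pos-OnCircle p∈ zero = p∈
  pos-OnCircle {p} p∈ (suc u) with pos-suc p u
  ... | inj₁ (_ , moved) = subst (OnCircle N) (sym moved) (nxt-OnCircle (pos-OnCircle p∈ u))
  ... | inj₂ stayed      = subst (OnCircle N) (sym stayed) (pos-OnCircle p∈ u)

  cdist-pos≤ : ∀ {p} → OnCircle N p → ∀ u → u < N → cdist N p (pos N tour H p u) ≤ u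
  cdist-pos≤ {p} p∈ zero    _     = ≤-reflexive (cdist-self N p)
  cdist-pos≤ {p} p∈ (suc u) 1+u<N with pos-suc p u
  ... | inj₁ (_ , moved) = begin
    cdist N p (pos N tour H p (suc u))      ≡⟨ cong (cdist N p) moved ⟩
    cdist N p (nxt N (pos N tour H p u))    ≡⟨ cdist-nxt p∈ (pos-OnCircle p∈ u) (≤-<-trans (s≤s ih) 1+u<N) ⟩
    suc (cdist N p (pos N tour H p u))      ≤⟨ s≤s ih ⟩
    suc u                                   ∎
    where
    open ≤-Reasoning
    ih : cdist N p (pos N tour H p u) ≤ u
    ih = cdist-pos≤ p∈ u (<-trans (n<1+n u) 1+u<N)
  ... | inj₂ stayed = begin
    cdist N p (pos N tour H p (suc u))      ≡⟨ cong (cdist N p) stayed ⟩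
    cdist N p (pos N tour H p u)            ≤⟨ cdist-pos≤ p∈ u (<-trans (n<1+n u) 1+u<N) ⟩
    u                                       ≤⟨ n≤1+n u ⟩
    suc u                                   ∎
    where open ≤-Reasoning

  cdist-pos-mono : ∀ {p} → OnCircle N p → ∀ u → suc u < N →
                   cdist N p (pos N tour H p u) ≤ cdist N p (pos N tour H p (suc u))
  cdist-pos-mono {p} p∈ u 1+u<N with pos-suc p u
  ... | inj₁ (_ , moved) = begin
    cdist N p (pos N tour H p u)            ≤⟨ n≤1+n _ ⟩
    suc (cdist N p (pos N tour H p u))      ≡⟨ cdist-nxt p∈ (pos-OnCircle p∈ u) (≤-<-trans (s≤s ih) 1+u<N) ⟨
    cdist N p (nxt N (pos N tour H p u))    ≡⟨ cong (cdist N p) moved ⟨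
    cdist N p (pos N tour H p (suc u))      ∎
    where
    open ≤-Reasoning
    ih : cdist N p (pos N tour H p u) ≤ u
    ih = cdist-pos≤ p∈ u (<-trans (n<1+n u) 1+u<N)
  ... | inj₂ stayed = ≤-reflexive (cong (cdist N p) (sym stayed))

  inCI-pos-suc : ∀ {p x} → OnCircle N p → OnCircle N x → ∀ u → suc u < N →
                 inCI p (pos N tour H p u) x ≡ true → inCI p (pos N tour H p (suc u)) x ≡ true
  inCI-pos-suc {p} p∈ (1≤x , x≤N) u 1+u<N h =
    cdist≤⇒inCI {N} {p} 1≤x (proj₂ (pos-OnCircle p∈ (suc u)))
      (≤-trans (inCI⇒cdist≤ {N} {p} x≤N h) (cdist-pos-mono p∈ u 1+u<N))

  cpred-∉ : ∀ {m} → OnCircle N m → ∀ u → suc u < N → inCI m (pos N tour H m u) (cpred N m) ≢ true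
  cpred-∉ {m} m∈ u 1+u<N h = <⇒≱ 1+u≤N∸1 (begin
    N ∸ 1                                   ≡⟨ cdist-cpred m∈ ⟨
    cdist N m (cpred N m)                   ≤⟨ inCI⇒cdist≤ {N} {m} (proj₂ (cpred-OnCircle m∈)) h ⟩
    cdist N m (pos N tour H m u)            ≤⟨ cdist-pos≤ m∈ u (<-trans (n<1+n u) 1+u<N) ⟩
    u                                       ∎)
    where
    open ≤-Reasoning
    1+u≤N∸1 : suc u ≤ N ∸ 1
    1+u≤N∸1 = m+n≤o⇒m≤o∸n (suc u) (subst (_≤ N) (+-comm 1 (suc u)) 1+u<N)

  module Follow (G : TGraph n) (τ : ℕ → ℕ) (H≡G∘τ : ∀ u → H (suc u) ≡ G (τ (suc u)))
                (t : ℕ) (τ-incr : ∀ u → u < t → τ u < τ (suc u)) (p : ℕ) where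

    τ₀≤ : ∀ u → u ≤ t → τ 0 ≤ τ u
    τ₀≤ zero    _   = ≤-refl
    τ₀≤ (suc u) u<t = ≤-trans (τ₀≤ u (<⇒≤ u<t)) (<⇒≤ (τ-incr u u<t))

    follow : ∀ u → u ≤ t →
             Σ (TWalkIn G (τ 0) (τ u) (tour p) (tour (pos N tour H p u)))
               λ σ → ∀ {u'} → u' ≤ u → tour (pos N tour H p u') ∈ vertices σ
    follow zero    _   = stay , λ { z≤n → here refl }
    follow (suc u) u<t with follow u (<⇒≤ u<t) | pos-suc p u
    ... | σ , visited | inj₁ (moves , moved) = σ' , visited'
      where
      move : TWalkIn G (τ u) (τ (suc u)) (tour (pos N tour H p u)) (tour (pos N tour H p (suc u)))
      move = hop (τ (suc u)) (τ-incr u u<t) ≤-refl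
               (subst₂ (λ K y → edgeIn K (tour (pos N tour H p u)) (tour y) ≡ true) (H≡G∘τ u) (sym moved) moves)
      σ' : TWalkIn G (τ 0) (τ (suc u)) (tour p) (tour (pos N tour H p (suc u)))
      σ' = append (τ₀≤ u (<⇒≤ u<t)) (<⇒≤ (τ-incr u u<t)) σ move
      visited' : ∀ {u'} → u' ≤ suc u → tour (pos N tour H p u') ∈ vertices σ'
      visited' u'≤1+u with m≤n⇒m<n∨m≡n u'≤1+u
      ... | inj₁ u'<1+u =
        ∈-append⁺ˡ (τ₀≤ u (<⇒≤ u<t)) (<⇒≤ (τ-incr u u<t)) σ move (visited (≤-pred u'<1+u))
      ... | inj₂ refl   = end∈vertices σ'
    ... | σ , visited | inj₂ stayed = σ' , visited'
      where
      σ' : TWalkIn G (τ 0) (τ (suc u)) (tour p) (tour (pos N tour H p (suc u)))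
      σ' = retarget (cong tour (sym stayed)) (widen ≤-refl (<⇒≤ (τ-incr u u<t)) σ)
      visited' : ∀ {u'} → u' ≤ suc u → tour (pos N tour H p u') ∈ vertices σ'
      visited' u'≤1+u with m≤n⇒m<n∨m≡n u'≤1+u
      ... | inj₁ u'<1+u = visited (≤-pred u'<1+u)
      ... | inj₂ refl   = end∈vertices σ'

  Covering : ℕ → List ℕ → Set
  Covering u A = ∀ {x} → OnCircle N x → ∃ λ p → p ∈ A × inCI p (pos N tour H p u) x ≡ true

  prune-Covering : ∀ {u A B} → Prune (Covered N tour H u) A B → Covering u A → Covering u B
  prune-Covering (stop _) cov = cov
  prune-Covering {u} {A} (remove {p = p} _ p-covered rest) cov = prune-Covering {u} rest cov'
    where
    cov' : Covering u (without p A)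
    cov' x∈ with cov x∈
    ... | q , q∈A , hq with q ≟ p
    ...   | no q≢p = q , ∈-without A q∈A q≢p , hq
    ...   | yes refl with p-covered _ (proj₁ x∈) (proj₂ x∈) hq
    ...     | r , r∈A , r≢p , hr = r , ∈-without A r∈A r≢p , hr

  module Run (t : ℕ) (As : ℕ → List ℕ) (run : IsRun N tour H t As) (1+t<N : suc t < N) where

    active-OnCircle : ∀ u → u ≤ t → ∀ {p} → p ∈ As u → OnCircle N p
    active-OnCircle zero    _   p∈ = ∈-interval⁻ (subst (_ ∈_) (proj₁ run) p∈)
    active-OnCircle (suc u) u<t p∈ =
      active-OnCircle u (<⇒≤ u<t) (prune-⊆ (proj₂ run (suc u) (s≤s z≤n) u<t) p∈)

    active-Covering : ∀ u → u ≤ t → Covering u (As u)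
    active-Covering zero _ {x} (1≤x , x≤N) =
      x , subst (x ∈_) (sym (proj₁ run)) (∈-interval⁺ 1≤x x≤N) , cdist≤⇒inCI {N} {x} 1≤x x≤N ≤-refl
    active-Covering (suc u) u<t = prune-Covering (proj₂ run (suc u) (s≤s z≤n) u<t) moved
      where
      moved : Covering (suc u) (As u)
      moved x∈ with active-Covering u (<⇒≤ u<t) x∈
      ... | p , p∈ , hp =
        p , p∈ , inCI-pos-suc (active-OnCircle u (<⇒≤ u<t) p∈) x∈ u (≤-<-trans u<t (<-trans (n<1+n t) 1+t<N)) hp

    -- The active intervals cover cpred N m, which the interval of m cannot contain: it spans at
    -- most t + 1 < N states.
    another-active : ∀ {m} → m ∈ As t → ∃ λ p → p ∈ As t × p ≢ m
    another-active m∈ with active-Covering t ≤-refl (cpred-OnCircle (active-OnCircle t ≤-refl m∈))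
    ... | p , p∈ , hp = p , p∈ , λ { refl → cpred-∉ (active-OnCircle t ≤-refl m∈) t 1+t<N hp }

module _ {A : Set} {R : A → A → Set} (R-refl : ∀ {x} → R x x)
         (R-trans : ∀ {x y z} → R x y → R y z → R x z) (R-total : ∀ x y → R x y ⊎ R y x) where

  greatestBy : ∀ {P : A → Set} → Decidable P → ∀ xs →
               (∃ λ m → m ∈ xs × P m × ∀ {y} → y ∈ xs → P y → R y m) ⊎ (∀ {y} → y ∈ xs → ¬ P y)
  greatestBy P? [] = inj₂ λ ()
  greatestBy P? (x ∷ xs) with greatestBy P? xs | P? x
  ... | inj₂ none | no ¬Px = inj₂ λ { (here refl) → ¬Px ; (there y∈) → none y∈ }
  ... | inj₂ none | yes Px =
    inj₁ (x , here refl , Px , λ { (here refl) _ → R-refl ; (there y∈) Py → ⊥-elim (none y∈ Py) })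
  ... | inj₁ (m , m∈ , Pm , below) | no ¬Px =
    inj₁ (m , there m∈ , Pm , λ { (here refl) Px → ⊥-elim (¬Px Px) ; (there y∈) → below y∈ })
  ... | inj₁ (m , m∈ , Pm , below) | yes Px with R-total x m
  ...   | inj₁ xRm = inj₁ (m , there m∈ , Pm , λ { (here refl) _ → xRm ; (there y∈) → below y∈ })
  ...   | inj₂ mRx =
    inj₁ (x , here refl , Px , λ { (here refl) _ → R-refl ; (there y∈) Py → R-trans (below y∈ Py) mRx })

greatest : ∀ {P : ℕ → Set} → Decidable P → ∀ xs →
           (∃ λ m → m ∈ xs × P m × ∀ {y} → y ∈ xs → P y → y ≤ m) ⊎ (∀ {y} → y ∈ xs → ¬ P y)
greatest = greatestBy ≤-refl ≤-trans ≤-total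

least : ∀ {P : ℕ → Set} → Decidable P → ∀ xs →
        (∃ λ m → m ∈ xs × P m × ∀ {y} → y ∈ xs → P y → m ≤ y) ⊎ (∀ {y} → y ∈ xs → ¬ P y)
least = greatestBy ≤-refl (λ y≥x z≥y → ≤-trans z≥y y≥x) (λ x y → ≤-total y x)

inCO-inside : ∀ {m m' q} → m ≤ q → q < m' → inCO m m' q ≡ true
inCO-inside {m} {m'} {q} m≤q q<m' with m ≤ᵇ m' | ≤ᵇ-reflects-≤ m m'
... | true  | _        rewrite ≤ᵇ-true m≤q | ≤ᵇ-true (<⇒≤ q<m') | ≡ᵇ-false (<⇒≢ q<m') = refl
... | false | ofⁿ m≰m' = ⊥-elim (m≰m' (≤-trans m≤q (<⇒≤ q<m')))

inCO-wrap : ∀ {m m' q} → m' < m → m ≤ q ⊎ q < m' → inCO m m' q ≡ true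
inCO-wrap {m} {m'} {q} m'<m side with m ≤ᵇ m' | ≤ᵇ-reflects-≤ m m'
... | true  | ofʸ m≤m' = ⊥-elim (<⇒≱ m'<m m≤m')
... | false | _ with side
...   | inj₁ m≤q  rewrite ≤ᵇ-true m≤q | ≡ᵇ-false (≢-sym (<⇒≢ (<-≤-trans m'<m m≤q))) = refl
...   | inj₂ q<m' rewrite ≤ᵇ-true (<⇒≤ q<m') | ∨-zeroʳ (m ≤ᵇ q) | ≡ᵇ-false (<⇒≢ q<m') = refl

module Union (Afin : ℕ → List ℕ) where

  ⋃ : ℕ → List ℕ
  ⋃ zero    = []
  ⋃ (suc ρ) = Afin (suc ρ) ++ ⋃ ρ

  ∈-⋃⁺ : ∀ {ρ y} → InUnion ρ Afin y → y ∈ ⋃ ρ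
  ∈-⋃⁺ {zero}  (i , 1≤i , i≤0 , _) = ⊥-elim (<⇒≱ 1≤i i≤0)
  ∈-⋃⁺ {suc ρ} (i , 1≤i , i≤1+ρ , y∈) with m≤n⇒m<n∨m≡n i≤1+ρ
  ... | inj₁ i<1+ρ = ∈-++⁺ʳ (Afin (suc ρ)) (∈-⋃⁺ (i , 1≤i , ≤-pred i<1+ρ , y∈))
  ... | inj₂ refl  = ∈-++⁺ˡ y∈

  ∈-⋃⁻ : ∀ {ρ y} → y ∈ ⋃ ρ → InUnion ρ Afin y
  ∈-⋃⁻ {suc ρ} y∈ with ∈-++⁻ (Afin (suc ρ)) y∈
  ... | inj₁ y∈A = suc ρ , s≤s z≤n , ≤-refl , y∈A
  ... | inj₂ y∈⋃ with ∈-⋃⁻ y∈⋃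
  ...   | i , 1≤i , i≤ρ , y∈A = i , 1≤i , m≤n⇒m≤1+n i≤ρ , y∈A

  -- m is the largest element ≤ q (the largest element overall if there is none) and m' the
  -- element following m cyclically.
  cyclic-cover : ∀ {ρ a a'} → InUnion ρ Afin a → InUnion ρ Afin a' → a ≢ a' →
                 ∀ q → ∃₂ λ m m' → Consecutive ρ Afin m m' × inCO m m' q ≡ true
  cyclic-cover {ρ} {a} {a'} a∈ a'∈ a≢a' q
    with greatest (λ _ → yes tt) (⋃ ρ) | least (λ _ → yes tt) (⋃ ρ)
  ... | inj₂ none | _ = ⊥-elim (none (∈-⋃⁺ a∈) tt)
  ... | _ | inj₂ none = ⊥-elim (none (∈-⋃⁺ a∈) tt)
  ... | inj₁ (hi , hi∈ , _ , ≤hi) | inj₁ (lo , lo∈ , _ , lo≤) = cover (greatest (_≤? q) (⋃ ρ))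
    where
    U : ℕ → Set
    U = InUnion ρ Afin
    all≤hi : ∀ y → U y → y ≤ hi
    all≤hi y y∈ = ≤hi (∈-⋃⁺ y∈) tt
    lo≤all : ∀ y → U y → lo ≤ y
    lo≤all y y∈ = lo≤ (∈-⋃⁺ y∈) tt
    lo<hi : lo < hi
    lo<hi = ≤∧≢⇒< (≤-trans (lo≤all a a∈) (all≤hi a a∈)) λ lo≡hi → a≢a' (≤-antisym
      (≤-trans (all≤hi a a∈) (≤-trans (≤-reflexive (sym lo≡hi)) (lo≤all a' a'∈)))
      (≤-trans (all≤hi a' a'∈) (≤-trans (≤-reflexive (sym lo≡hi)) (lo≤all a a∈))))
    wrap : ∀ {m} → U m → (∀ y → U y → y ≤ m) → Consecutive ρ Afin m lo
    wrap m∈ all≤m = m∈ , ∈-⋃⁻ lo∈ , inj₂ (all≤m , lo≤all)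
    cover : (∃ λ m → m ∈ ⋃ ρ × m ≤ q × ∀ {y} → y ∈ ⋃ ρ → y ≤ q → y ≤ m) ⊎
            (∀ {y} → y ∈ ⋃ ρ → ¬ y ≤ q) →
            ∃₂ λ m m' → Consecutive ρ Afin m m' × inCO m m' q ≡ true
    cover (inj₂ none≤q) = hi , lo , wrap (∈-⋃⁻ hi∈) all≤hi , inCO-wrap lo<hi (inj₂ (≰⇒> (none≤q lo∈)))
    cover (inj₁ (m , m∈ , m≤q , below)) with least (m <?_) (⋃ ρ)
    ... | inj₂ none>m =
      m , lo , wrap (∈-⋃⁻ m∈) (λ y y∈ → ≮⇒≥ (none>m (∈-⋃⁺ y∈))) ,
      inCO-wrap (<-≤-trans lo<hi (≮⇒≥ (none>m hi∈))) (inj₁ m≤q)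
    ... | inj₁ (m' , m'∈ , m<m' , above) =
      m , m' ,
      (∈-⋃⁻ m∈ , ∈-⋃⁻ m'∈ , inj₁ (m<m' , λ y y∈ (m<y , y<m') → <⇒≱ y<m' (above (∈-⋃⁺ y∈) m<y))) ,
      inCO-inside m≤q (≰⇒> λ m'≤q → <⇒≱ m<m' (below m'∈ m'≤q))

eqFin-sound : ∀ {n} {a b : Fin n} → T (eqFin a b) → a ≡ b
eqFin-sound {a = a} {b} t with a F.≟ b
... | yes a≡b = a≡b
... | no  _   = ⊥-elim t

sameEdge-sound : ∀ {n} {a b c d : Fin n} → sameEdge (a , b) (c , d) ≡ true →
                 (a ≡ c × b ≡ d) ⊎ (a ≡ d × b ≡ c)
sameEdge-sound {a = a} {b} {c} {d} h with Equivalence.to (T-∨ {eqFin a c ∧ eqFin b d}) (Equivalence.from T-≡ h)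
... | inj₁ same with Equivalence.to (T-∧ {eqFin a c}) same
...   | a≈c , b≈d = inj₁ (eqFin-sound a≈c , eqFin-sound b≈d)
sameEdge-sound {a = a} {b} {c} {d} h | inj₂ flip with Equivalence.to (T-∧ {eqFin a d}) flip
...   | a≈d , b≈c = inj₂ (eqFin-sound a≈d , eqFin-sound b≈c)

module Tour {n : ℕ} (T : List (Edge n)) (tour : ℕ → Fin n) (dfs : IsDFSTour n T tour) where

  OnTour : Fin n → Set
  OnTour x = ∃ λ q → OnCircle (tourLen n) q × tour q ≡ x

  endpoints-OnTour : ∀ {c d} → (c , d) ∈ T → OnTour c × OnTour d
  endpoints-OnTour {c} {d} e∈T
    with count-pos (λ q → sameEdge (c , d) (tourEdge (tourLen n) tour q)) (interval 1 (tourLen n))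
                   (subst (0 <_) (sym (All.lookup (proj₂ dfs) e∈T)) (s≤s z≤n))
  ... | q , q∈ , traversed with ∈-interval⁻ q∈
  ...   | q∈N with sameEdge-sound {a = c} {d} {tour q} {tour (nxt (tourLen n) q)} traversed
  ...     | inj₁ (refl , refl) = (q , q∈N , refl) , (nxt (tourLen n) q , nxt-OnCircle q∈N , refl)
  ...     | inj₂ (refl , refl) = (nxt (tourLen n) q , nxt-OnCircle q∈N , refl) , (q , q∈N , refl)

  OnTour-TPath : ∀ {a x} → TPath T a x → OnTour a → OnTour x
  OnTour-TPath here            a∈ = a∈
  OnTour-TPath (step {v} {w} edge rest) _ with find edge
  ... | (c , d) , e∈T , e≈vw with sameEdge-sound {a = c} {d} {v} {w} e≈vw
  ...   | inj₁ (_ , refl) = OnTour-TPath rest (proj₂ (endpoints-OnTour e∈T))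
  ...   | inj₂ (refl , _) = OnTour-TPath rest (proj₁ (endpoints-OnTour e∈T))

  all-OnTour : ∀ {L G} → 2 ≤ n → IsSpanningTree n L G T → ∀ x → OnTour x
  all-OnTour {L} {G} 2≤n (_ , _ , connected) x =
    OnTour-TPath (connected (tour 1) x) (1 , (≤-refl , 1≤N 2≤n) , refl)
    where
    1≤N : ∀ {m} → 2 ≤ m → 1 ≤ tourLen m
    1≤N {suc (suc m)} _ = s≤s z≤n
    1≤N {suc zero} (s≤s ())

tSteps*k≤n∸1 : ∀ n k → tSteps (tourLen n) (suc k) * suc k ≤ n ∸ 1
tSteps*k≤n∸1 n k = begin
  tSteps (tourLen n) (suc k) * suc k      ≡⟨ cong (_* suc k) (m*n/m*o≡n/o 2 (n ∸ 1) (suc k)) ⟩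
  (n ∸ 1) / suc k * suc k                 ≤⟨ m/n*n≤m (n ∸ 1) (suc k) ⟩
  n ∸ 1                                   ∎
  where open ≤-Reasoning

n<tourLen : ∀ {n} → 3 ≤ n → n < tourLen n
n<tourLen {suc zero}          (s≤s ())
n<tourLen {suc (suc zero)}    (s≤s (s≤s ()))
n<tourLen {suc (suc (suc m))} _ =
  s≤s (s≤s (≤-trans (m≤n+m (suc (suc m)) m) (≤-reflexive (cong (λ z → m + suc (suc z)) (sym (+-identityʳ m))))))

module EpochWalks {n : ℕ} (k Δ L : ℕ) (G : TGraph n) (T : List (Edge n)) (tour : ℕ → Fin n)
                  (ρ : ℕ) (b : ℕ → ℕ) (ep : Epochs (suc k) Δ L G T ρ b)
                  (tc : TemporallyConnected n L Δ G) (1≤n : 1 ≤ n) where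

  N : ℕ
  N = tourLen n

  t : ℕ
  t = tSteps N (suc k)

  position : ℕ → ℕ → ℕ → ℕ
  position i p u = pos N tour (Hep (suc k) Δ G T b i) p u

  AgentsVisited : (ℕ → ℕ) → ℕ → ∀ {lo hi v w} → TWalkIn G lo hi v w → Set
  AgentsVisited s j σ = ∀ {i u} → 1 ≤ i → i ≤ j → u ≤ t → tour (position i (s i) u) ∈ vertices σ

  b-incr : ∀ j → j < ρ → b j < b (suc j)
  b-incr j j<ρ = proj₁ (proj₂ ep) (suc j) (s≤s z≤n) j<ρ

  b≤L : ∀ {j} → j ≤ ρ → b j ≤ L
  b≤L j≤ρ = ≤-trans (≤-last ρ b b-incr j≤ρ) (proj₁ (proj₂ (proj₂ ep)))

  module Epoch (j : ℕ) (j<ρ : j < ρ) where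

    deficient? : ℕ → Bool
    deficient? τ = deficient (suc k) T (G τ)

    lo hi : ℕ
    lo = b j + Δ
    hi = b (suc j)

    roundabout R : List ℕ
    roundabout = interval (suc lo) hi
    R = roundTimes (suc k) Δ G T b (suc j)

    -- The repositioning part contains at most Δ of the deficient snapshots of the epoch.
    n≤k*count : n ≤ suc k * count deficient? roundabout
    n≤k*count = +-cancelˡ-≤ (suc k * Δ) n _ (begin
      suc k * Δ + n                                       ≤⟨ proj₂ (proj₂ (proj₂ ep)) (suc j) (s≤s z≤n) j<ρ ⟩
      suc k * count deficient? (interval (suc (b j)) hi)
        ≤⟨ *-monoʳ-≤ (suc k) (count-interval-drop deficient? (suc (b j)) hi Δ) ⟩
      suc k * (Δ + count deficient? roundabout)           ≡⟨ *-distribˡ-+ (suc k) Δ _ ⟩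
      suc k * Δ + suc k * count deficient? roundabout     ∎)
      where open ≤-Reasoning

    t<count : t < count deficient? roundabout
    t<count = *-cancelʳ-< (suc k) t _ (begin-strict
      t * suc k                                 ≤⟨ tSteps*k≤n∸1 n k ⟩
      n ∸ 1                                     <⟨ ∸-monoʳ-< {n} {1} {0} (s≤s z≤n) 1≤n ⟩
      n                                         ≤⟨ n≤k*count ⟩
      suc k * count deficient? roundabout       ≡⟨ *-comm (suc k) _ ⟩
      count deficient? roundabout * suc k       ∎)
      where open ≤-Reasoning

    lo<hi : lo < hi
    lo<hi with count-pos deficient? roundabout (≤-<-trans z≤n t<count)
    ... | y , y∈ , _ = ≤-trans (proj₁ (∈-interval⁻ y∈)) (proj₂ (∈-interval⁻ y∈))

    length-R : length R ≡ t
    length-R = trans (length-take t _)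
                     (m≤n⇒m⊓n≡m (subst (t ≤_) (count≡length-filterᵇ deficient? roundabout) (<⇒≤ t<count)))

    -- τ 0 is the end of the repositioning part and τ u, for u ≥ 1, the time of step u of the
    -- roundabout process (at is 1-indexed), so that Hep … (suc u) is G (τ (suc u)) by definition.
    τ : ℕ → ℕ
    τ u = at (lo ∷ R) (suc u)

    R-within : All (λ τ → lo < τ × τ ≤ hi) R
    R-within = All.take⁺ t (All.filter⁺ (T? ∘ deficient?) (All.tabulate {xs = roundabout} ∈-interval⁻))

    R-sorted : AllPairs _<_ R
    R-sorted = AllPairs.take⁺ t (AllPairs.filter⁺ (T? ∘ deficient?) (AllPairs-interval (suc lo) hi))

    τ-incr : ∀ u → u < t → τ u < τ (suc u)
    τ-incr u u<t =
      at-< u (All.map proj₁ R-within ∷ R-sorted) (subst (suc (suc u) ≤_) (cong suc (sym length-R)) (s≤s u<t))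

    τt≤hi : τ t ≤ hi
    τt≤hi = at-All t (<⇒≤ lo<hi ∷ All.map proj₂ R-within) (s≤s (≤-reflexive (sym length-R)))

    walk : ∀ p w → ∃₂ λ w' (σ : TWalkIn G (b j) hi w w') →
             ∀ {u} → u ≤ t → tour (position (suc j) p u) ∈ vertices σ
    walk p w = _ , append (m≤m+n (b j) Δ) (<⇒≤ lo<hi) toStart shadow ,
               λ u≤t → ∈-append⁺ʳ (m≤m+n (b j) Δ) (<⇒≤ lo<hi) toStart shadow (visited u≤t)
      where
      open Agent.Follow N tour (Hep (suc k) Δ G T b (suc j)) G τ (λ _ → refl) t τ-incr p
      toStart : TWalkIn G (b j) lo w (tour p)
      toStart = reposition tc (b j) (≤-trans (<⇒≤ lo<hi) (b≤L j<ρ)) w (tour p)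
      shadow : TWalkIn G lo hi (tour p) (tour (position (suc j) p t))
      shadow = widen ≤-refl τt≤hi (proj₁ (follow t ≤-refl))
      visited : ∀ {u} → u ≤ t → tour (position (suc j) p u) ∈ vertices shadow
      visited = proj₂ (follow t ≤-refl)

  walkThroughEpochs : ∀ s j → j ≤ ρ → ∀ v → ∃₂ λ w (σ : TWalkIn G 0 (b j) v w) → AgentsVisited s j σ
  walkThroughEpochs s zero    _   v = v , stay , λ 1≤i i≤0 _ → ⊥-elim (<⇒≱ 1≤i i≤0)
  walkThroughEpochs s (suc j) j<ρ v with walkThroughEpochs s j (<⇒≤ j<ρ) v
  ... | w , σ , visited with Epoch.walk j j<ρ (s (suc j)) w
  ...   | w' , σ' , visited' = w' , σ'' , visits
    where
    σ'' : TWalkIn G 0 (b (suc j)) v w'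
    σ'' = append z≤n (<⇒≤ (b-incr j j<ρ)) σ σ'
    visits : AgentsVisited s (suc j) σ''
    visits 1≤i i≤1+j u≤t with m≤n⇒m<n∨m≡n i≤1+j
    ... | inj₁ i<1+j = ∈-append⁺ˡ z≤n (<⇒≤ (b-incr j j<ρ)) σ σ' (visited 1≤i (≤-pred i<1+j) u≤t)
    ... | inj₂ refl  = ∈-append⁺ʳ z≤n (<⇒≤ (b-incr j j<ρ)) σ σ' (visited' u≤t)

  reach : 1 ≤ ρ → ∀ v w → TWalkIn G 0 (b ρ) v w
  reach 1≤ρ v w = widen z≤n (≤-trans (<⇒≤ (Epoch.lo<hi 0 1≤ρ)) (≤-last ρ b b-incr 1≤ρ))
                    (reposition tc (b 0) (≤-trans (<⇒≤ (Epoch.lo<hi 0 1≤ρ)) (b≤L 1≤ρ)) v w)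

  1+t<N : 3 ≤ n → suc t < N
  1+t<N 3≤n = begin-strict
    suc t          ≤⟨ s≤s (≤-trans (m≤m*n t (suc k)) (tSteps*k≤n∸1 n k)) ⟩
    suc (n ∸ 1)    ≡⟨ trans (+-comm 1 (n ∸ 1)) (m∸n+n≡m 1≤n) ⟩
    n              <⟨ n<tourLen 3≤n ⟩
    N              ∎
    where open ≤-Reasoning

  explores : ∀ {v w} (σ : TWalkIn G 0 (b ρ) v w) → (∀ x → x ∈ vertices σ) →
             ∃ λ ws → IsTWalk G 0 v ws × (∀ x → x ≡ v ⊎ x ∈ map proj₂ ws) ×
                      All (λ st → InEpochs ρ b (proj₁ st)) ws
  explores σ all∈ =
    steps σ , isTWalk σ , (λ x → vertex (all∈ x)) ,
    All.zipWith (λ (0<τ , τ≤bρ) → InEpochs⁺ ρ b (proj₁ ep) b-incr 0<τ τ≤bρ)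
                (IsTWalk⇒after G (steps σ) (isTWalk σ) , byHi σ)
    where
    vertex : ∀ {x v xs} → x ∈ v ∷ xs → x ≡ v ⊎ x ∈ xs
    vertex (here x≡v) = inj₁ x≡v
    vertex (there x∈) = inj₂ x∈

-- For ρ = 0 the two conjuncts of IsRho contradict each other, since 0 ∸ 1 = 0.
IsRho⇒1≤ρ : ∀ {k ρ} → IsRho k ρ → 1 ≤ ρ
IsRho⇒1≤ρ {ρ = zero}  (e^0>M , e^0≯M) = ⊥-elim (e^0≯M e^0>M)
IsRho⇒1≤ρ {ρ = suc _} _               = s≤s z≤n

other : Fin 2 → Fin 2
other F.zero    = F.suc F.zero
other (F.suc _) = F.zero

all∈vertices-to-other : ∀ {G : TGraph 2} {lo hi} v (σ : TWalkIn G lo hi v (other v)) → ∀ x → x ∈ vertices σ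
all∈vertices-to-other F.zero         σ F.zero         = here refl
all∈vertices-to-other F.zero         σ (F.suc F.zero) = end∈vertices σ
all∈vertices-to-other (F.suc F.zero) σ F.zero         = end∈vertices σ
all∈vertices-to-other (F.suc F.zero) σ (F.suc F.zero) = here refl

lemma13 : (n k Δ L : ℕ) (G : TGraph n) (T : List (Edge n)) (tour : ℕ → Fin n)
          (ρ : ℕ) (b : ℕ → ℕ) (As : ℕ → ℕ → List ℕ) (s : ℕ → ℕ) →
          2 ≤ n → 1 ≤ k → 1 ≤ Δ →
          IsSpanningTree n L G T →
          IsDFSTour n T tour →
          IsRho k ρ →
          Epochs k Δ L G T ρ b →
          TemporallyConnected n L Δ G →
          (∀ i → 1 ≤ i → i ≤ ρ →
             IsRun (tourLen n) tour (Hep k Δ G T b i) (tSteps (tourLen n) k) (As i)) →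
          (∀ i → 1 ≤ i → i ≤ ρ → s i ∈ As i (tSteps (tourLen n) k)) →
          (∀ m m' → Consecutive ρ (λ i → As i (tSteps (tourLen n) k)) m m' →
             ∃ λ i → 1 ≤ i × i ≤ ρ ×
               (∀ x → 1 ≤ x → x ≤ tourLen n → inCO m m' x ≡ true →
                  ∃ λ u → u ≤ tSteps (tourLen n) k ×
                    pos (tourLen n) tour (Hep k Δ G T b i) (s i) u ≡ x)) →
          (v : Fin n) →
          ∃ λ ws → IsTWalk G 0 v ws ×
                   (∀ (x : Fin n) → x ≡ v ⊎ x ∈ map proj₂ ws) ×
                   All (λ st → InEpochs ρ b (proj₁ st)) ws
lemma13 _ zero _ _ _ _ _ _ _ _ _ _ () _ _ _ _ _ _ _ _ _ _
lemma13 (suc zero) (suc _) _ _ _ _ _ _ _ _ _ (s≤s ()) _ _ _ _ _ _ _ _ _ _ _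
lemma13 (suc (suc zero)) (suc k) Δ L G T tour ρ b As s _ _ _ _ _ isRho ep tc _ _ _ v =
  explores σ (all∈vertices-to-other v σ)
  where
  open EpochWalks k Δ L G T tour ρ b ep tc (s≤s z≤n)
  σ : TWalkIn G 0 (b ρ) v (other v)
  σ = reach (IsRho⇒1≤ρ {suc k} isRho) v (other v)
lemma13 (suc (suc (suc n))) (suc k) Δ L G T tour ρ b As s 2≤n _ _ st dfs isRho ep tc run s∈A covered v =
  explores σ all∈
  where
  open EpochWalks k Δ L G T tour ρ b ep tc (s≤s z≤n)
  1≤ρ : 1 ≤ ρ
  1≤ρ = IsRho⇒1≤ρ {suc k} isRho
  walk : ∃₂ λ w (σ : TWalkIn G 0 (b ρ) v w) → AgentsVisited s ρ σ
  walk = walkThroughEpochs s ρ ≤-refl v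
  σ : TWalkIn G 0 (b ρ) v (proj₁ walk)
  σ = proj₁ (proj₂ walk)
  open Agent.Run N tour (Hep (suc k) Δ G T b 1) t (As 1) (run 1 ≤-refl 1≤ρ) (1+t<N (s≤s (s≤s (s≤s z≤n))))
  all∈ : ∀ x → x ∈ vertices σ
  all∈ x with Tour.all-OnTour T tour dfs {L} {G} 2≤n st x | another-active (s∈A 1 ≤-refl 1≤ρ)
  ... | q , (1≤q , q≤N) , refl | p , p∈ , p≢s₁
    with Union.cyclic-cover (λ i → As i t) (1 , ≤-refl , 1≤ρ , p∈) (1 , ≤-refl , 1≤ρ , s∈A 1 ≤-refl 1≤ρ)
                            p≢s₁ q
  ... | m , m' , consecutive , q∈I with covered m m' consecutive
  ... | i , 1≤i , i≤ρ , visits with visits q 1≤q q≤N q∈I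
  ... | u , u≤t , refl = proj₂ (proj₂ walk) 1≤i i≤ρ u≤t
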